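{- For every quadrilateral $Q$ (possibly improper) over a field $\mathbb{k}$ of characteristic $\neq2$, the symmetric bilinear form $\langle -,-\rangle_Q$ on $\mathbb{k}^2$ is nondegenerate.
   Context: Every line $L$ has an equation $tX-uY+v=0$ normalized so that $t=1$ if $u=0$ and $u=1$ if $u\ne0$; write $t_L,u_L,v_L$. A quadrilateral $Q=ABA'B'$: four distinct lines $A,B,A',B'$, not all concurrent, with adjacent sides ($\{A,B\},\{B,A'\},\{A',B'\},\{B',A\}$) not parallel (three sides may be concurrent). $\alpha = t_Au_Bu_{A'}u_{B'} - u_At_Bu_{A'}u_{B'} + u_Au_Bt_{A'}u_{B'} - u_Au_Bu_{A'}t_{B'}$, $\beta = t_Au_Bt_{A'}u_{B'}-u_At_Bu_{A'}t_{B'}$, $\gamma = t_At_Bt_{A'}u_{B'}-t_At_Bu_{A'}t_{B'}+t_Au_Bt_{A'}t_{B'}-u_At_Bt_{A'}t_{B'}$; $\langle \mathbf v,\mathbf w\rangle_Q=\mathbf v^T\begin{pmatrix}\gamma&-\beta\\-\beta&\alpha\end{pmatrix}\mathbf w$. -}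

module Defs where

open import Level using (Level; _⊔_; suc)
open import Algebra.Bundles using (CommutativeRing)
open import Data.Product using (Σ; ∃; _×_; _,_)
open import Data.Empty using (⊥)
open import Relation.Nullary using (¬_)

record Field (c ℓ : Level) : Set (suc (c ⊔ ℓ)) where
  field
    commutativeRing : CommutativeRing c ℓ
  open CommutativeRing commutativeRing public
  field
    1≉0     : ¬ (1# ≈ 0#)
    inverse : ∀ x → ¬ (x ≈ 0#) → ∃ λ y → x * y ≈ 1#

CharNot2 : ∀ {c ℓ} → Field c ℓ → Set ℓ
CharNot2 k = ¬ (1# + 1# ≈ 0#)
  where open Field k

module _ {c ℓ} (k : Field c ℓ) where
  open Field k

  -- A line in k², given by its normalized equation tX - uY + v = 0:
  --   vert v      : t = 1, u = 0   (equation X + v = 0)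
  --   nonvert t v : u = 1          (equation tX - Y + v = 0)
  -- Each line has exactly one normalized equation, so lines correspond
  -- bijectively to these data (up to ≈ on coefficients).
  data Line : Set c where
    vert    : (v : Carrier) → Line
    nonvert : (t v : Carrier) → Line

  t_ : Line → Carrier
  t (vert v) = 1#
  t (nonvert t' v) = t'

  u_ : Line → Carrier
  u (vert v) = 0#
  u (nonvert t' v) = 1#

  v_ : Line → Carrier
  v (vert v') = v'
  v (nonvert t' v') = v'

  SameLine : Line → Line → Set ℓ
  SameLine (vert v) (vert v') = v ≈ v'
  SameLine (vert v) (nonvert t' v') = Level.Lift ℓ ⊥
  SameLine (nonvert t' v) (vert v') = Level.Lift ℓ ⊥
  SameLine (nonvert t v) (nonvert t' v') = (t ≈ t') × (v ≈ v')

  Distinct : Line → Line → Set ℓ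
  Distinct L M = ¬ SameLine L M

  Parallel : Line → Line → Set ℓ
  Parallel L M = (t L) * (u M) ≈ (u L) * (t M)

  OnLine : Carrier → Carrier → Line → Set ℓ
  OnLine x y L = (t L) * x - (u L) * y + v L ≈ 0#

  AllConcurrent : Line → Line → Line → Line → Set (c ⊔ ℓ)
  AllConcurrent A B A' B' =
    Σ Carrier λ x → Σ Carrier λ y →
      OnLine x y A × OnLine x y B × OnLine x y A' × OnLine x y B'

  -- A quadrilateral Q = A B A' B' (possibly improper: three sides may be concurrent)
  record IsQuadrilateral (A B A' B' : Line) : Set (c ⊔ ℓ) where
    field
      dAB   : Distinct A B
      dAA'  : Distinct A A'
      dAB'  : Distinct A B'
      dBA'  : Distinct B A'
      dBB'  : Distinct B B'
      dA'B' : Distinct A' B'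
      notAllConcurrent : ¬ AllConcurrent A B A' B'
      npAB   : ¬ Parallel A B
      npBA'  : ¬ Parallel B A'
      npA'B' : ¬ Parallel A' B'
      npB'A  : ¬ Parallel B' A

  αQ βQ γQ : Line → Line → Line → Line → Carrier
  αQ A B A' B' =
      t A * u B * u A' * u B' - u A * t B * u A' * u B'
    + u A * u B * t A' * u B' - u A * u B * u A' * t B'
  βQ A B A' B' = t A * u B * t A' * u B' - u A * t B * u A' * t B'
  γQ A B A' B' =
      t A * t B * t A' * u B' - t A * t B * u A' * t B'
    + t A * u B * t A' * t B' - u A * t B * t A' * t B'

  form : Line → Line → Line → Line →
         Carrier × Carrier → Carrier × Carrier → Carrier
  form A B A' B' (v₁ , v₂) (w₁ , w₂) =
      v₁ * (γQ A B A' B' * w₁ + (- βQ A B A' B') * w₂)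
    + v₂ * ((- βQ A B A' B') * w₁ + αQ A B A' B' * w₂)

  Nondegenerate : (Carrier × Carrier → Carrier × Carrier → Carrier) → Set (c ⊔ ℓ)
  Nondegenerate b = ∀ (p : Carrier × Carrier) →
    (∀ (q : Carrier × Carrier) → b p q ≈ 0#) →
    let (p₁ , p₂) = p in (p₁ ≈ 0#) × (p₂ ≈ 0#)

-- The Gram matrix [[γ, -β], [-β, α]] has determinant
--   αγ - β² = -(t_A u_B - u_A t_B)(t_B u_A' - u_B t_A')(t_A' u_B' - u_A' t_B')(t_B' u_A - u_B' t_A),
-- a polynomial identity in the eight direction coordinates.  Each factor is the
-- determinant of the directions of two adjacent sides, hence nonzero, so the
-- Gram matrix is invertible.
module Submission where

open import Algebra.Bundles using (CommutativeRing)
import Algebra.Properties.Ring as RingProperties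
import Algebra.Properties.Semiring.Mult as SemiringMult
import Algebra.Solver.Ring
import Algebra.Solver.Ring.AlmostCommutativeRing as ACR
open import Data.Integer.Base as ℤ using (ℤ; +_; -[1+_]; +0; +[1+_])
import Data.Integer.Properties as ℤ
import Data.Nat.Base as ℕ
import Data.Nat.Properties as ℕ
import Data.Sign.Base as Sign
open import Data.Maybe.Base using (Maybe; just; nothing)
open import Data.Product using (_,_)
open import Relation.Nullary using (¬_; yes; no)
import Relation.Binary.PropositionalEquality as ≡
import Relation.Binary.Reasoning.Setoid as SetoidReasoning

open import Defs

-- The ring solver needs a coefficient ring with decidable equality mapping into R.
module IntegerCoefficients {c ℓ} (R : CommutativeRing c ℓ) where
  open CommutativeRing R
  open RingProperties ring
  open SemiringMult semiring using (_×_; ×-homo-+; ×1-homo-*)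
  open SetoidReasoning setoid

  fromℤ : ℤ → Carrier
  fromℤ (+ n)    = n × 1#
  fromℤ -[1+ n ] = - (ℕ.suc n × 1#)

  fromℤ-homo-neg : ∀ z → fromℤ (ℤ.- z) ≈ - fromℤ z
  fromℤ-homo-neg -[1+ n ] = sym (-‿involutive _)
  fromℤ-homo-neg +0       = sym -0#≈0#
  fromℤ-homo-neg +[1+ n ] = refl

  ×1-homo-∸ : ∀ m n → n ℕ.≤ m → (m ℕ.∸ n) × 1# ≈ m × 1# - n × 1#
  ×1-homo-∸ m n n≤m = begin
    (m ℕ.∸ n) × 1#                    ≈⟨ //-rightDividesʳ (n × 1#) _ ⟨
    ((m ℕ.∸ n) × 1# + n × 1#) - n × 1# ≈⟨ +-congʳ (×-homo-+ 1# (m ℕ.∸ n) n) ⟨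
    ((m ℕ.∸ n ℕ.+ n) × 1#) - n × 1#   ≡⟨ ≡.cong (λ k → k × 1# - n × 1#) (ℕ.m∸n+n≡m n≤m) ⟩
    m × 1# - n × 1#                   ∎

  fromℤ-⊖ : ∀ m n → fromℤ (m ℤ.⊖ n) ≈ m × 1# - n × 1#
  fromℤ-⊖ m n with m ℕ.<? n
  ... | yes m<n rewrite ℤ.⊖-< m<n = begin
    fromℤ (ℤ.- + (n ℕ.∸ m)) ≈⟨ fromℤ-homo-neg (+ (n ℕ.∸ m)) ⟩
    - ((n ℕ.∸ m) × 1#)      ≈⟨ -‿cong (×1-homo-∸ n m (ℕ.<⇒≤ m<n)) ⟩
    - (n × 1# - m × 1#)     ≈⟨ ⁻¹-anti-homo‿- _ _ ⟩
    m × 1# - n × 1#         ∎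
  ... | no m≮n rewrite ℤ.⊖-≥ (ℕ.≮⇒≥ m≮n) = ×1-homo-∸ m n (ℕ.≮⇒≥ m≮n)

  fromℤ-homo-+ : ∀ x y → fromℤ (x ℤ.+ y) ≈ fromℤ x + fromℤ y
  fromℤ-homo-+ -[1+ m ] -[1+ n ] = begin
    - (ℕ.suc (ℕ.suc (m ℕ.+ n)) × 1#)  ≡⟨ ≡.cong (λ k → - (ℕ.suc k × 1#)) (ℕ.+-suc m n) ⟨
    - ((ℕ.suc m ℕ.+ ℕ.suc n) × 1#)    ≈⟨ -‿cong (×-homo-+ 1# (ℕ.suc m) (ℕ.suc n)) ⟩
    - (ℕ.suc m × 1# + ℕ.suc n × 1#)   ≈⟨ -‿+-comm _ _ ⟨
    - (ℕ.suc m × 1#) + - (ℕ.suc n × 1#) ∎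
  fromℤ-homo-+ -[1+ m ] (+ n)    = trans (fromℤ-⊖ n (ℕ.suc m)) (+-comm _ _)
  fromℤ-homo-+ (+ m)    -[1+ n ] = fromℤ-⊖ m (ℕ.suc n)
  fromℤ-homo-+ (+ m)    (+ n)    = ×-homo-+ 1# m n

  fromSign : Sign.Sign → Carrier
  fromSign Sign.+ = 1#
  fromSign Sign.- = - 1#

  fromSign-homo-* : ∀ s t → fromSign (s Sign.* t) ≈ fromSign s * fromSign t
  fromSign-homo-* Sign.- Sign.- = begin
    1#          ≈⟨ -‿involutive 1# ⟨
    - - 1#      ≈⟨ -1*x≈-x (- 1#) ⟨
    - 1# * - 1# ∎
  fromSign-homo-* Sign.- Sign.+ = sym (*-identityʳ _)
  fromSign-homo-* Sign.+ _      = sym (*-identityˡ _)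

  fromℤ-◃ : ∀ s n → fromℤ (s ℤ.◃ n) ≈ fromSign s * (n × 1#)
  fromℤ-◃ _      ℕ.zero    = sym (zeroʳ _)
  fromℤ-◃ Sign.- (ℕ.suc n) = sym (-1*x≈-x _)
  fromℤ-◃ Sign.+ (ℕ.suc n) = sym (*-identityˡ _)

  fromℤ-sign-abs : ∀ z → fromℤ z ≈ fromSign (ℤ.sign z) * (ℤ.∣ z ∣ × 1#)
  fromℤ-sign-abs z = begin
    fromℤ z                           ≡⟨ ≡.cong fromℤ (ℤ.◃-inverse z) ⟨
    fromℤ (ℤ.sign z ℤ.◃ ℤ.∣ z ∣)      ≈⟨ fromℤ-◃ (ℤ.sign z) ℤ.∣ z ∣ ⟩
    fromSign (ℤ.sign z) * (ℤ.∣ z ∣ × 1#) ∎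

  *-interchange : ∀ a b c d → (a * b) * (c * d) ≈ (a * c) * (b * d)
  *-interchange a b c d = begin
    (a * b) * (c * d) ≈⟨ *-assoc a b (c * d) ⟩
    a * (b * (c * d)) ≈⟨ *-congˡ (*-assoc b c d) ⟨
    a * ((b * c) * d) ≈⟨ *-congˡ (*-congʳ (*-comm b c)) ⟩
    a * ((c * b) * d) ≈⟨ *-congˡ (*-assoc c b d) ⟩
    a * (c * (b * d)) ≈⟨ *-assoc a c (b * d) ⟨
    (a * c) * (b * d) ∎

  fromℤ-homo-* : ∀ x y → fromℤ (x ℤ.* y) ≈ fromℤ x * fromℤ y
  fromℤ-homo-* x y = begin
    fromℤ (sx Sign.* sy ℤ.◃ ∣x∣ ℕ.* ∣y∣)              ≈⟨ fromℤ-◃ (sx Sign.* sy) (∣x∣ ℕ.* ∣y∣) ⟩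
    fromSign (sx Sign.* sy) * ((∣x∣ ℕ.* ∣y∣) × 1#)    ≈⟨ *-cong (fromSign-homo-* sx sy) (×1-homo-* ∣x∣ ∣y∣) ⟩
    (fromSign sx * fromSign sy) * (∣x∣ × 1# * ∣y∣ × 1#) ≈⟨ *-interchange _ _ _ _ ⟩
    (fromSign sx * ∣x∣ × 1#) * (fromSign sy * ∣y∣ × 1#) ≈⟨ *-cong (fromℤ-sign-abs x) (fromℤ-sign-abs y) ⟨
    fromℤ x * fromℤ y                                  ∎
    where
    sx = ℤ.sign x
    sy = ℤ.sign y
    ∣x∣ = ℤ.∣ x ∣
    ∣y∣ = ℤ.∣ y ∣

  fromℤ-morphism : ℤ.+-*-rawRing ACR.-Raw-AlmostCommutative⟶ ACR.fromCommutativeRing R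
  fromℤ-morphism = record
    { ⟦_⟧    = fromℤ
    ; +-homo = fromℤ-homo-+
    ; *-homo = fromℤ-homo-*
    ; -‿homo = fromℤ-homo-neg
    ; 0-homo = refl
    ; 1-homo = +-identityʳ 1#
    }

  weakly-decide : ∀ x y → Maybe (fromℤ x ≈ fromℤ y)
  weakly-decide x y with x ℤ.≟ y
  ... | yes ≡.refl = just refl
  ... | no _       = nothing

  open Algebra.Solver.Ring ℤ.+-*-rawRing (ACR.fromCommutativeRing R) fromℤ-morphism weakly-decide public

module FieldLemmas {c ℓ} (k : Field c ℓ) where
  open import Data.Product using (_×_)
  open Field k
  open RingProperties ring
  open IntegerCoefficients commutativeRing
  open SetoidReasoning setoid

  x*y≈0⇒x≈0 : ∀ {x y} → ¬ y ≈ 0# → x * y ≈ 0# → x ≈ 0#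
  x*y≈0⇒x≈0 {x} {y} y≉0 xy≈0 with inverse y y≉0
  ... | y⁻¹ , yy⁻¹≈1 = begin
    x              ≈⟨ *-identityʳ x ⟨
    x * 1#         ≈⟨ *-congˡ yy⁻¹≈1 ⟨
    x * (y * y⁻¹)  ≈⟨ *-assoc x y y⁻¹ ⟨
    (x * y) * y⁻¹  ≈⟨ *-congʳ xy≈0 ⟩
    0# * y⁻¹       ≈⟨ zeroˡ y⁻¹ ⟩
    0#             ∎

  x*y≉0 : ∀ {x y} → ¬ x ≈ 0# → ¬ y ≈ 0# → ¬ x * y ≈ 0#
  x*y≉0 x≉0 y≉0 xy≈0 = x≉0 (x*y≈0⇒x≈0 y≉0 xy≈0)

  -x≉0 : ∀ {x} → ¬ x ≈ 0# → ¬ - x ≈ 0#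
  -x≉0 {x} x≉0 -x≈0 = x≉0 (begin
    x      ≈⟨ -‿involutive x ⟨
    - - x  ≈⟨ -‿cong -x≈0 ⟩
    - 0#   ≈⟨ -0#≈0# ⟩
    0#     ∎)

  symmetricForm : Carrier → Carrier → Carrier →
                  Carrier × Carrier → Carrier × Carrier → Carrier
  symmetricForm p q r (v₁ , v₂) (w₁ , w₂) =
    v₁ * (p * w₁ + q * w₂) + v₂ * (q * w₁ + r * w₂)

  -- Pairing with the columns of the adjugate matrix isolates each coordinate.
  symmetricForm-adjugate₁ : ∀ p q r v₁ v₂ →
    symmetricForm p q r (v₁ , v₂) (r , - q) ≈ v₁ * (p * r - q * q)
  symmetricForm-adjugate₁ = solve 5 (λ p q r v₁ v₂ →
    v₁ :* (p :* r :+ q :* (:- q)) :+ v₂ :* (q :* r :+ r :* (:- q))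
      := v₁ :* (p :* r :- q :* q)) refl

  symmetricForm-adjugate₂ : ∀ p q r v₁ v₂ →
    symmetricForm p q r (v₁ , v₂) (- q , p) ≈ v₂ * (p * r - q * q)
  symmetricForm-adjugate₂ = solve 5 (λ p q r v₁ v₂ →
    v₁ :* (p :* (:- q) :+ q :* p) :+ v₂ :* (q :* (:- q) :+ r :* p)
      := v₂ :* (p :* r :- q :* q)) refl

  det≉0⇒symmetricForm-nondegenerate : ∀ p q r → ¬ p * r - q * q ≈ 0# →
    Nondegenerate k (symmetricForm p q r)
  det≉0⇒symmetricForm-nondegenerate p q r det≉0 (v₁ , v₂) v⊥ =
      x*y≈0⇒x≈0 det≉0 (trans (sym (symmetricForm-adjugate₁ p q r v₁ v₂)) (v⊥ (r , - q)))
    , x*y≈0⇒x≈0 det≉0 (trans (sym (symmetricForm-adjugate₂ p q r v₁ v₂)) (v⊥ (- q , p)))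

module QuadrilateralLemmas {c ℓ} (k : Field c ℓ) where
  open Field k
  open RingProperties ring
  open IntegerCoefficients commutativeRing
  open FieldLemmas k

  cross : Line k → Line k → Carrier
  cross L M = t_ k L * u_ k M - u_ k L * t_ k M

  ¬parallel⇒cross≉0 : ∀ L M → ¬ Parallel k L M → ¬ cross L M ≈ 0#
  ¬parallel⇒cross≉0 _ _ ¬LM cross≈0 = ¬LM (x∙y⁻¹≈ε⇒x≈y _ _ cross≈0)

  gram-det : ∀ A B A' B' →
    let α = αQ k A B A' B'; β = βQ k A B A' B'; γ = γQ k A B A' B' in
    γ * α - (- β) * (- β) ≈ - (cross A B * cross B A' * cross A' B' * cross B' A)
  gram-det A B A' B' =
    solve 8 (λ ta ua tb ub tc uc td ud →
        (ta :* tb :* tc :* ud :- ta :* tb :* uc :* td :+ ta :* ub :* tc :* td :- ua :* tb :* tc :* td)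
          :* (ta :* ub :* uc :* ud :- ua :* tb :* uc :* ud :+ ua :* ub :* tc :* ud :- ua :* ub :* uc :* td)
        :- (:- (ta :* ub :* tc :* ud :- ua :* tb :* uc :* td))
          :* (:- (ta :* ub :* tc :* ud :- ua :* tb :* uc :* td))
      := :- ((ta :* ub :- ua :* tb) :* (tb :* uc :- ub :* tc) :* (tc :* ud :- uc :* td) :* (td :* ua :- ud :* ta)))
      refl
      (t_ k A) (u_ k A) (t_ k B) (u_ k B) (t_ k A') (u_ k A') (t_ k B') (u_ k B')

  gram-det≉0 : ∀ {A B A' B'} → IsQuadrilateral k A B A' B' →
    let α = αQ k A B A' B'; β = βQ k A B A' B'; γ = γQ k A B A' B' in
    ¬ γ * α - (- β) * (- β) ≈ 0#
  gram-det≉0 {A} {B} {A'} {B'} Q det≈0 =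
    -x≉0 (x*y≉0 (x*y≉0 (x*y≉0 (¬parallel⇒cross≉0 A B npAB) (¬parallel⇒cross≉0 B A' npBA'))
                        (¬parallel⇒cross≉0 A' B' npA'B'))
                 (¬parallel⇒cross≉0 B' A npB'A))
         (trans (sym (gram-det A B A' B')) det≈0)
    where open IsQuadrilateral Q

lemma2p2 : ∀ {c ℓ} (k : Field c ℓ) → CharNot2 k →
    ∀ (A B A' B' : Line k) → IsQuadrilateral k A B A' B' →
    Nondegenerate k (form k A B A' B')
lemma2p2 k _ A B A' B' Q =
  det≉0⇒symmetricForm-nondegenerate (γQ k A B A' B') (- βQ k A B A' B') (αQ k A B A' B')
    (gram-det≉0 Q)
  where
  open Field k
  open FieldLemmas k
  open QuadrilateralLemmas k
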